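{- Let \(\mathcal V\) be a universe. (i) There exists a small \(\delta_{\mathcal V}\)-complete poset (with carrier in some universe) that is nontrivial if and only if the type \(\Omega^{\neg\neg}_{\mathcal V}\) has size \(\mathcal V\). (ii) There exists a small \(\delta_{\mathcal V}\)-complete poset (with carrier in some universe) that is positive if and only if the type \(\Omega_{\mathcal V}\) has size \(\mathcal V\).
   Context: Setting: univalent foundations, i.e. intensional Martin-Löf type theory with a hierarchy of type universes (successor universe \(\mathcal U^+\) with \(\mathcal U:\mathcal U^+\), and join \(\mathcal U\sqcup\mathcal V\)), function extensionality, propositional extensionality and propositional truncations \(\|X\|\); \(\exists_{x:X}Y(x)\) abbreviates \(\|\Sigma_{x:X}Y(x)\|\). Neither excluded middle nor propositional resizing is assumed. A proposition is a type with at most one element. \(\Omega_{\mathcal V}\) is the type of propositions in \(\mathcal V\); a proposition \(P\) is \(\neg\neg\)-stable if \(\neg\neg P\to P\), and \(\Omega^{\neg\neg}_{\mathcal V}\) is the type of \(\neg\neg\)-stable propositions in \(\mathcal V\). A type \(X\) has size \(\mathcal V\) if there is \(Y:\mathcal V\) with \(Y\simeq X\). A poset is a type \(X\) with a proposition-valued relation \(\sqsubseteq\) that is reflexive, transitive and antisymmetric. For \(x\sqsubseteq y\) in \(X\) and a proposition \(P:\mathcal V\), let \(\delta_{x,y,P}:\mathbf 1+P\to X\) send \(\mathrm{inl}(\star)\mapsto x\) and \(\mathrm{inr}(p)\mapsto y\). The poset is \(\delta_{\mathcal V}\)-complete if every such family \(\delta_{x,y,P}\) (for all \(x\sqsubseteq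 y\) and all propositions \(P:\mathcal V\)) has a supremum \(\bigvee\delta_{x,y,P}\) in \(X\). It is locally small if there is \(\sqsubseteq_{\mathcal V}:X\to X\to\mathcal V\) with \((x\sqsubseteq y)\simeq(x\sqsubseteq_{\mathcal V}y)\) for all \(x,y\); it is small if it is locally small and its carrier \(X\) has size \(\mathcal V\). A poset is nontrivial if it comes with designated elements \(x,y\) with \(x\sqsubseteq y\) and \(x\neq y\). In a \(\delta_{\mathcal V}\)-complete poset, \(x\) is strictly below \(y\) if \(x\sqsubseteq y\) and for every \(z\) with \(y\sqsubseteq z\) and every proposition \(P:\mathcal V\), the equality \(z=\bigvee\delta_{x,z,P}\) implies \(P\). A \(\delta_{\mathcal V}\)-complete poset is positive if it comes with designated elements \(x,y\) with \(x\) strictly below \(y\). -}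

module Defs where

open import Level using (Level; _⊔_; suc; Setω)
open import Data.Product using (Σ; Σ-syntax; _×_; _,_; proj₁)
open import Data.Sum using (_⊎_; inj₁; inj₂)
open import Data.Unit using (⊤; tt)
open import Relation.Nullary using (¬_)
open import Relation.Binary.PropositionalEquality using (_≡_; _≢_)
open import Function.Bundles using (_↔_)
open import Axiom.Extensionality.Propositional using (Extensionality)

is-prop : ∀ {ℓ} → Set ℓ → Set ℓ
is-prop X = (a b : X) → a ≡ b

FunExt : Setω
FunExt = ∀ {a b} → Extensionality a b

PropExt : Setω
PropExt = ∀ {ℓ} {P Q : Set ℓ} → is-prop P → is-prop Q → (P → Q) → (Q → P) → P ≡ Q

record PropTrunc : Setω where
  field
    ∥_∥     : ∀ {ℓ} → Set ℓ → Set ℓ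
    ∥∥-prop : ∀ {ℓ} {A : Set ℓ} → is-prop ∥ A ∥
    ∣_∣     : ∀ {ℓ} {A : Set ℓ} → A → ∥ A ∥
    ∥∥-rec  : ∀ {ℓ ℓ'} {A : Set ℓ} {B : Set ℓ'} → is-prop B → (A → B) → ∥ A ∥ → B

Ω : (v : Level) → Set (suc v)
Ω v = Σ (Set v) is-prop

Ω¬¬ : (v : Level) → Set (suc v)
Ω¬¬ v = Σ (Ω v) (λ P → ¬ ¬ (proj₁ P) → proj₁ P)

has-size : ∀ {ℓ} (v : Level) → Set ℓ → Set (suc v ⊔ ℓ)
has-size v X = Σ (Set v) (λ Y → Y ↔ X)

record UFPoset (u t : Level) : Set (suc (u ⊔ t)) where
  field
    Carrier   : Set u
    _⊑_       : Carrier → Carrier → Set t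
    ⊑-prop    : ∀ x y → is-prop (x ⊑ y)
    ⊑-refl    : ∀ x → x ⊑ x
    ⊑-trans   : ∀ x y z → x ⊑ y → y ⊑ z → x ⊑ z
    ⊑-antisym : ∀ x y → x ⊑ y → y ⊑ x → x ≡ y

module _ {u t : Level} (v : Level) (𝓟 : UFPoset u t) where
  open UFPoset 𝓟

  δ : Carrier → Carrier → (P : Set v) → ⊤ ⊎ P → Carrier
  δ x y P (inj₁ _) = x
  δ x y P (inj₂ _) = y

  is-sup : {I : Set v} → (I → Carrier) → Carrier → Set (u ⊔ t ⊔ v)
  is-sup {I} α s = ((i : I) → α i ⊑ s) × ((z : Carrier) → ((i : I) → α i ⊑ z) → s ⊑ z)

  is-δ-complete : Set (u ⊔ t ⊔ suc v)
  is-δ-complete = (x y : Carrier) → x ⊑ y → (P : Set v) → is-prop P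
                → Σ Carrier (is-sup (δ x y P))

  is-locally-small : Set (u ⊔ t ⊔ suc v)
  is-locally-small = Σ (Carrier → Carrier → Set v) (λ R → (x y : Carrier) → (x ⊑ y) ↔ R x y)

  is-small : Set (u ⊔ t ⊔ suc v)
  is-small = is-locally-small × has-size v Carrier

  Nontrivial : Set (u ⊔ t)
  Nontrivial = Σ Carrier (λ x → Σ Carrier (λ y → (x ⊑ y) × (x ≢ y)))

  module _ (c : is-δ-complete) where
    ⋁δ : (x y : Carrier) → x ⊑ y → (P : Set v) → is-prop P → Carrier
    ⋁δ x y l P pP = proj₁ (c x y l P pP)

    strictly-below : Carrier → Carrier → Set (u ⊔ t ⊔ suc v)
    strictly-below x y = Σ (x ⊑ y) (λ l → (z : Carrier) (m : y ⊑ z)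
                           (P : Set v) (pP : is-prop P)
                           → z ≡ ⋁δ x z (⊑-trans x y z l m) P pP → P)

    Positive : Set (u ⊔ t ⊔ suc v)
    Positive = Σ Carrier (λ x → Σ Carrier (λ y → strictly-below x y))

-- "There exists a small δ_v-complete poset (carrier in some universe)
--  that is nontrivial / positive" : existential over universe levels,
--  hence a record in Setω.

record SmallNontrivialδPoset (v : Level) : Setω where
  field
    u t      : Level
    poset    : UFPoset u t
    complete : is-δ-complete v poset
    small    : is-small v poset
    nontriv  : Nontrivial v poset

record SmallPositiveδPoset (v : Level) : Setω where
  field
    u t      : Level
    poset    : UFPoset u t
    complete : is-δ-complete v poset
    small    : is-small v poset
    positive : Positive v poset complete

record _⇔ω_ {ℓ} (A : Setω) (B : Set ℓ) : Setω where
  field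
    to   : A → B
    from : B → A

record _×ω_ (A B : Setω) : Setω where
  constructor _,ω_
  field
    fst : A
    snd : B

-- Conversely, the (¬¬-stable) propositions in v ordered by implication form a
-- δ_v-complete poset, ⋁ δ_{P,Q,S} being (the ¬¬-closure of) ∥ P ∨ (S ∧ Q) ∥, with
-- ⊥ ≠ ⊤ and, in Ω, ⊥ strictly below ⊤.  Forward, a nontrivial x ⊑ y makes
-- P ↦ ⋁δ x y P a section of z ↦ ¬ (z ⊑ x) on ¬¬-stable P, and a strict x ⊏ y makes it
-- a section of z ↦ (y ⊑ z) on all P; a retract of a small poset is small, since the
-- fixed points of the idempotent are cut out by a v-valued equality.
module Submission where

open import Defs
open import Level using (Level; _⊔_; Lift; lift; lower) renaming (suc to lsuc)
open import Data.Product using (Σ; _×_; _,_; proj₁; proj₂)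
open import Data.Sum using (_⊎_; inj₁; inj₂)
open import Data.Unit using (⊤; tt)
open import Data.Empty using (⊥; ⊥-elim)
open import Relation.Nullary using (¬_)
open import Relation.Binary.PropositionalEquality using (_≡_; refl; sym; trans; cong; cong₂; subst)
open import Function.Base using (id)
open import Function.Bundles using (_↔_; _↩_; Inverse; LeftInverse; mk↔ₛ′; mk↩)
open import Function.Consequences.Propositional using (strictlyInverseˡ⇒inverseˡ)
open import Axiom.UniquenessOfIdentityProofs.WithK using (uip)

Σ-prop-≡ : ∀ {a b} {A : Set a} {B : A → Set b} → (∀ x → is-prop (B x))
         → {p q : Σ A B} → proj₁ p ≡ proj₁ q → p ≡ q
Σ-prop-≡ B-prop {a , b} {.a , c} refl = cong (a ,_) (B-prop a b c)

×-prop : ∀ {a b} {A : Set a} {B : Set b} → is-prop A → is-prop B → is-prop (A × B)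
×-prop A-prop B-prop (a , b) (a' , b') = cong₂ _,_ (A-prop a a') (B-prop b b')

↔-prop : ∀ {a b} {A : Set a} {B : Set b} → A ↔ B → is-prop A → is-prop B
↔-prop e A-prop x y = trans (sym (strictlyInverseˡ x))
  (trans (cong to (A-prop _ _)) (strictlyInverseˡ y))
  where open Inverse e

has-small-identity : ∀ {x} (v : Level) → Set x → Set (x ⊔ lsuc v)
has-small-identity v X = Σ (X → X → Set v) λ E →
  (∀ z w → is-prop (E z w)) × (∀ z w → E z w → z ≡ w) × (∀ z → E z z)

retract-has-size : ∀ {v a x} {A : Set a} {X : Set x}
  → has-size v X → has-small-identity v X → X ↩ A → has-size v A
retract-has-size {A = A} (Y , e) (E , E-prop , E-≡ , E-refl) ρ = Fix , mk↔ₛ′ f g f∘g g∘f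
  where
  open LeftInverse ρ renaming (to to r; from to s; strictlyInverseˡ to r∘s)
  open Inverse e using () renaming (to to ι; from to ι⁻¹)
  open Inverse e using (strictlyInverseˡ; strictlyInverseʳ)

  Fix : Set _
  Fix = Σ Y λ y → E (s (r (ι y))) (ι y)

  f : Fix → A
  f (y , _) = r (ι y)

  g : A → Fix
  g a = ι⁻¹ (s a) , subst (λ w → E (s (r w)) w) (sym (strictlyInverseˡ (s a)))
          (subst (λ b → E (s b) (s a)) (sym (r∘s a)) (E-refl (s a)))

  f∘g : ∀ a → f (g a) ≡ a
  f∘g a = trans (cong r (strictlyInverseˡ (s a))) (r∘s a)

  g∘f : ∀ p → g (f p) ≡ p
  g∘f (y , fixed) = Σ-prop-≡ (λ _ → E-prop _ _)
    (trans (cong ι⁻¹ (E-≡ _ _ fixed)) (strictlyInverseʳ y))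

locally-small⇒has-small-identity : ∀ {u t v} (𝓟 : UFPoset u t)
  → is-locally-small v 𝓟 → has-small-identity v (UFPoset.Carrier 𝓟)
locally-small⇒has-small-identity 𝓟 (R , ⊑↔R) =
  (λ z w → R z w × R w z) ,
  (λ z w → ×-prop (R-prop z w) (R-prop w z)) ,
  (λ z w (a , b) → ⊑-antisym z w (Inverse.from (⊑↔R z w) a) (Inverse.from (⊑↔R w z) b)) ,
  (λ z → Inverse.to (⊑↔R z z) (⊑-refl z) , Inverse.to (⊑↔R z z) (⊑-refl z))
  where
  open UFPoset 𝓟
  R-prop : ∀ z w → is-prop (R z w)
  R-prop z w = ↔-prop (⊑↔R z w) (⊑-prop z w)

small-retract-has-size : ∀ {u t v a} (𝓟 : UFPoset u t) {A : Set a}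
  → is-small v 𝓟 → UFPoset.Carrier 𝓟 ↩ A → has-size v A
small-retract-has-size 𝓟 (ls , size) =
  retract-has-size size (locally-small⇒has-small-identity 𝓟 ls)

⊥Ω ⊤Ω : (v : Level) → Ω v
⊥Ω v = Lift v ⊥ , λ ()
⊤Ω v = Lift v ⊤ , λ _ _ → refl

module δ-Sup {u t v} (𝓟 : UFPoset u t) (c : is-δ-complete v 𝓟) where
  open UFPoset 𝓟

  module _ {x y : Carrier} (x⊑y : x ⊑ y) {P : Set v} (P-prop : is-prop P) where
    ⋁ : Carrier
    ⋁ = ⋁δ v 𝓟 c x y x⊑y P P-prop

    ⊑-⋁ : P → y ⊑ ⋁
    ⊑-⋁ p = proj₁ (proj₂ (c x y x⊑y P P-prop)) (inj₂ p)

    ⋁-least : ∀ {z} → x ⊑ z → (P → y ⊑ z) → ⋁ ⊑ z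
    ⋁-least {z} x⊑z P→y⊑z = proj₂ (proj₂ (c x y x⊑y P P-prop)) z
      λ { (inj₁ _) → x⊑z ; (inj₂ p) → P→y⊑z p }

module _ (fe : FunExt) (pe : PropExt) where

  is-prop-is-prop : ∀ {ℓ} {X : Set ℓ} → is-prop (is-prop X)
  is-prop-is-prop f g = fe λ a → fe λ b → uip (f a b) (g a b)

  ¬-prop : ∀ {ℓ} {X : Set ℓ} → is-prop (¬ X)
  ¬-prop f g = fe λ x → ⊥-elim (f x)

  →-prop : ∀ {a b} {X : Set a} {Y : Set b} → is-prop Y → is-prop (X → Y)
  →-prop Y-prop f g = fe λ x → Y-prop (f x) (g x)

  Ω-≡ : ∀ {v} {P Q : Ω v} → (proj₁ P → proj₁ Q) → (proj₁ Q → proj₁ P) → P ≡ Q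
  Ω-≡ {P = P , P-prop} {Q , Q-prop} f g with pe P-prop Q-prop f g
  ... | refl = cong (P ,_) (is-prop-is-prop P-prop Q-prop)

  Ω¬¬-≡ : ∀ {v} {P Q : Ω¬¬ v} → (proj₁ (proj₁ P) → proj₁ (proj₁ Q))
        → (proj₁ (proj₁ Q) → proj₁ (proj₁ P)) → P ≡ Q
  Ω¬¬-≡ {P = P} {Q} f g =
    Σ-prop-≡ (λ X → →-prop (proj₂ X)) (Ω-≡ {P = proj₁ P} {proj₁ Q} f g)

  ¬-Ω¬¬ : ∀ {ℓ} → Set ℓ → Ω¬¬ ℓ
  ¬-Ω¬¬ X = ((¬ X) , ¬-prop) , λ ¬¬¬X x → ¬¬¬X λ ¬x → ¬x x

  module _ {u t v} (𝓟 : UFPoset u t) (c : is-δ-complete v 𝓟)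
           (ls : is-locally-small v 𝓟) where
    open UFPoset 𝓟
    R : Carrier → Carrier → Set v
    R = proj₁ ls
    ⊑↔R : ∀ z w → (z ⊑ w) ↔ R z w
    ⊑↔R = proj₂ ls
    open δ-Sup 𝓟 c
    open Inverse using (to; from)

    nontrivial⇒Ω¬¬-retract : Nontrivial v 𝓟 → Carrier ↩ Ω¬¬ v
    nontrivial⇒Ω¬¬-retract (x , y , x⊑y , x≢y) =
      mk↩ (strictlyInverseˡ⇒inverseˡ r r∘s)
      where
      s : Ω¬¬ v → Carrier
      s ((P , P-prop) , _) = ⋁ x⊑y P-prop

      r : Carrier → Ω¬¬ v
      r z = ¬-Ω¬¬ (R z x)

      r∘s : ∀ P → r (s P) ≡ P
      r∘s P@((_ , P-prop) , ¬¬-stable) = Ω¬¬-≡ {P = r (s P)} {P}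
        (λ ⋁⋢x → ¬¬-stable λ ¬p →
          ⋁⋢x (to (⊑↔R _ x) (⋁-least x⊑y P-prop (⊑-refl x) (λ p → ⊥-elim (¬p p)))))
        (λ p ⋁⊑x → x≢y (⊑-antisym x y x⊑y
          (⊑-trans y (s P) x (⊑-⋁ x⊑y P-prop p) (from (⊑↔R _ x) ⋁⊑x))))

    positive⇒Ω-retract : Positive v 𝓟 c → Carrier ↩ Ω v
    positive⇒Ω-retract (x , y , x⊑y , x⊏y) = mk↩ (strictlyInverseˡ⇒inverseˡ r r∘s)
      where
      s : Ω v → Carrier
      s (P , P-prop) = ⋁ x⊑y P-prop

      r : Carrier → Ω v
      r z = R y z , ↔-prop (⊑↔R y z) (⊑-prop y z)

      y≡⋁⇒P : ∀ {P} (P-prop : is-prop P) → y ≡ ⋁ x⊑y P-prop → P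
      y≡⋁⇒P P-prop y≡⋁ = x⊏y y (⊑-refl y) _ P-prop
        (subst (λ l → y ≡ ⋁ l P-prop) (⊑-prop x y _ _) y≡⋁)

      r∘s : ∀ P → r (s P) ≡ P
      r∘s P@(_ , P-prop) = Ω-≡ {P = r (s P)} {P}
        (λ y⊑⋁ → y≡⋁⇒P P-prop (⊑-antisym y (s P) (from (⊑↔R y _) y⊑⋁)
          (⋁-least x⊑y P-prop x⊑y (λ _ → ⊑-refl y))))
        (λ p → to (⊑↔R y _) (⊑-⋁ x⊑y P-prop p))

  Ω¬¬-poset : (v : Level) → UFPoset (lsuc v) v
  Ω¬¬-poset v = record
    { Carrier   = Ω¬¬ v
    ; _⊑_       = λ P Q → proj₁ (proj₁ P) → proj₁ (proj₁ Q)
    ; ⊑-prop    = λ P Q → →-prop (proj₂ (proj₁ Q))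
    ; ⊑-refl    = λ P p → p
    ; ⊑-trans   = λ P Q S f g p → g (f p)
    ; ⊑-antisym = λ P Q f g → Ω¬¬-≡ {P = P} {Q} f g
    }

  Ω¬¬-δ-complete : (v : Level) → is-δ-complete v (Ω¬¬-poset v)
  Ω¬¬-δ-complete v ((P , _) , _) ((Q , _) , _) _ S _ =
    ¬-Ω¬¬ (¬ (P ⊎ (S × Q))) ,
    (λ { (inj₁ _) p ¬∨ → ¬∨ (inj₁ p) ; (inj₂ s) q ¬∨ → ¬∨ (inj₂ (s , q)) }) ,
    (λ Z bound ¬¬∨ → proj₂ Z λ ¬z → ¬¬∨ λ
      { (inj₁ p) → ¬z (bound (inj₁ tt) p) ; (inj₂ (s , q)) → ¬z (bound (inj₂ s) q) })

  Ω¬¬-locally-small : (v : Level) → is-locally-small v (Ω¬¬-poset v)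
  Ω¬¬-locally-small v = UFPoset._⊑_ (Ω¬¬-poset v) , λ _ _ → mk↔ₛ′ id id (λ _ → refl) (λ _ → refl)

  Ω¬¬-nontrivial : (v : Level) → Nontrivial v (Ω¬¬-poset v)
  Ω¬¬-nontrivial v = ⊥Ω¬¬ , ⊤Ω¬¬ , (λ _ → lift tt) ,
    λ ⊥≡⊤ → lower (subst (λ P → proj₁ (proj₁ P)) (sym ⊥≡⊤) (lift tt))
    where
    ⊥Ω¬¬ ⊤Ω¬¬ : Ω¬¬ v
    ⊥Ω¬¬ = ⊥Ω v , λ ¬¬⊥ → ⊥-elim (¬¬⊥ λ ())
    ⊤Ω¬¬ = ⊤Ω v , λ _ → lift tt

  Ω-poset : (v : Level) → UFPoset (lsuc v) v
  Ω-poset v = record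
    { Carrier   = Ω v
    ; _⊑_       = λ P Q → proj₁ P → proj₁ Q
    ; ⊑-prop    = λ P Q → →-prop (proj₂ Q)
    ; ⊑-refl    = λ P p → p
    ; ⊑-trans   = λ P Q S f g p → g (f p)
    ; ⊑-antisym = λ P Q f g → Ω-≡ {P = P} {Q} f g
    }

  Ω-locally-small : (v : Level) → is-locally-small v (Ω-poset v)
  Ω-locally-small v = UFPoset._⊑_ (Ω-poset v) , λ _ _ → mk↔ₛ′ id id (λ _ → refl) (λ _ → refl)

  module _ (pt : PropTrunc) (v : Level) where
    open PropTrunc pt

    Ω-δ-complete : is-δ-complete v (Ω-poset v)
    Ω-δ-complete (P , _) (Q , _) _ S _ =
      (∥ P ⊎ (S × Q) ∥ , ∥∥-prop) ,
      (λ { (inj₁ _) p → ∣ inj₁ p ∣ ; (inj₂ s) q → ∣ inj₂ (s , q) ∣ }) ,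
      (λ Z bound → ∥∥-rec (proj₂ Z)
        λ { (inj₁ p) → bound (inj₁ tt) p ; (inj₂ (s , q)) → bound (inj₂ s) q })

    ⊥Ω-strictly-below-⊤Ω : strictly-below v (Ω-poset v) Ω-δ-complete (⊥Ω v) (⊤Ω v)
    ⊥Ω-strictly-below-⊤Ω = (λ ()) , λ Z ⊤⊑Z P P-prop Z≡⋁ →
      ∥∥-rec P-prop (λ { (inj₂ (p , _)) → p }) (subst proj₁ Z≡⋁ (⊤⊑Z (lift tt)))

theorem3p23 : FunExt → PropExt → PropTrunc → (v : Level)
    → (SmallNontrivialδPoset v ⇔ω has-size v (Ω¬¬ v))
    ×ω (SmallPositiveδPoset v ⇔ω has-size v (Ω v))
theorem3p23 fe pe pt v =
  record
    { to   = λ 𝓟 → let open SmallNontrivialδPoset 𝓟 in small-retract-has-size poset small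
        (nontrivial⇒Ω¬¬-retract fe pe poset complete (proj₁ small) nontriv)
    ; from = λ Ω¬¬-small → record
        { poset = Ω¬¬-poset fe pe v ; complete = Ω¬¬-δ-complete fe pe v
        ; small = Ω¬¬-locally-small fe pe v , Ω¬¬-small ; nontriv = Ω¬¬-nontrivial fe pe v }
    }
  ,ω
  record
    { to   = λ 𝓟 → let open SmallPositiveδPoset 𝓟 in small-retract-has-size poset small
        (positive⇒Ω-retract fe pe poset complete (proj₁ small) positive)
    ; from = λ Ω-small → record
        { poset = Ω-poset fe pe v ; complete = Ω-δ-complete fe pe pt v
        ; small = Ω-locally-small fe pe v , Ω-small
        ; positive = ⊥Ω v , ⊤Ω v , ⊥Ω-strictly-below-⊤Ω fe pe pt v }
    }
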